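{- Let $n\ge1$ and let $(h_{i,j},v_{i,j},d_{i,j})_{1\le i,j\le n}$ be an $n\times n$ Alternating Phase Matrix of type 4, and set $a_{i,j}=-\omega h_{i,j}+\omega^2v_{i,j}$ with $\omega=e^{2\pi i/3}$. Then for every $i$, $\sum_{j=1}^na_{i,j}\in\omega^2\mathbb Z$; for every $j$, $\sum_{i=1}^na_{i,j}\in\omega\mathbb Z$; and for every $\ell\in[1-n,n-1]$, $\sum_{i=\max(1,1-\ell)}^{\min(n,n-\ell)}a_{i,i+\ell}\in\mathbb Z$.
   Context: An $n\times n$ Alternating Phase Matrix of type 4 is an $n\times n$ array of triples $(h_{i,j},v_{i,j},d_{i,j})$ with $h_{i,j},v_{i,j},d_{i,j}\in\{0,1,-1\}$ and $h_{i,j}+v_{i,j}+d_{i,j}=0$, such that: (1) in each row $i$, the nonzero $h_{i,j}$, read for $j=1,\dots,n$, alternate $1,-1,1,\dots,-1$ (starting with $1$, ending with $-1$); (2) in each column $j$, the nonzero $v_{i,j}$, read for $i=1,\dots,n$, alternate $1,-1,1,\dots,-1$; (3) along each diagonal $\ell\in[1-n,n-1]$, the nonzero $d_{i,i+\ell}$, read for $i$ from $\max(1,1-\ell)$ to $\min(n,n-\ell)$, alternate $-1,1,-1,\dots,1$. -}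

module Defs where

open import Data.Nat as ℕ using (ℕ)
open import Data.Integer as ℤ using (ℤ; +_; -_; _≟_)
open import Data.Fin using (Fin; toℕ)
open import Data.List using (List; []; _∷_; map; filter; concatMap; foldr)
open import Data.List.Base using (allFin)
open import Data.Product using (∃; _×_)
open import Data.Sum using (_⊎_)
open import Relation.Nullary using (¬?)
open import Relation.Binary.PropositionalEquality using (_≡_)

-- Eisenstein integers ℤ[ω] ⊂ ℂ, ω = e^{2πi/3}, represented exactly as
-- re + im·ω (the basis {1, ω} of ℤ[ω] is ℤ-free, so this is faithful).
-- Relation ω² = -1 - ω.

record ℤω : Set where
  constructor mkℤω
  field
    re : ℤ
    im : ℤ
open ℤω public

_+ω_ : ℤω → ℤω → ℤω
mkℤω a b +ω mkℤω c d = mkℤω (a ℤ.+ c) (b ℤ.+ d)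

-- (a + bω)(c + dω) = ac + (ad + bc)ω + bd ω² = (ac - bd) + (ad + bc - bd)ω
_*ω_ : ℤω → ℤω → ℤω
mkℤω a b *ω mkℤω c d =
  mkℤω (a ℤ.* c ℤ.- b ℤ.* d) (a ℤ.* d ℤ.+ b ℤ.* c ℤ.- b ℤ.* d)

-ω_ : ℤω → ℤω
-ω mkℤω a b = mkℤω (- a) (- b)

0ω : ℤω
0ω = mkℤω (+ 0) (+ 0)

ι : ℤ → ℤω
ι k = mkℤω k (+ 0)

ω : ℤω
ω = mkℤω (+ 0) (+ 1)

ω² : ℤω
ω² = ω *ω ω

sumω : List ℤω → ℤω
sumω = foldr _+ω_ 0ω

_∈_ℤ : ℤω → ℤω → Set
z ∈ c ℤ = ∃ λ (k : ℤ) → z ≡ c *ω ι k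

nonzeros : List ℤ → List ℤ
nonzeros = filter (λ x → ¬? (x ≟ + 0))

data Alt (a b : ℤ) : List ℤ → Set where
  done : Alt a b []
  step : ∀ {xs} → Alt a b xs → Alt a b (a ∷ b ∷ xs)

AltPos : List ℤ → Set
AltPos xs = Alt (+ 1) (- + 1) (nonzeros xs)

AltNeg : List ℤ → Set
AltNeg xs = Alt (- + 1) (+ 1) (nonzeros xs)

Matrix : Set → ℕ → Set
Matrix A n = Fin n → Fin n → A

row : ∀ {A n} → Matrix A n → Fin n → List A
row M i = map (M i) (allFin _)

col : ∀ {A n} → Matrix A n → Fin n → List A
col M j = map (λ i → M i j) (allFin _)

diag : ∀ {A n} → Matrix A n → ℤ → List A
diag {n = n} M ℓ =
  concatMap (λ i → map (M i)
              (filter (λ j → (+ toℕ j) ≟ (+ toℕ i) ℤ.+ ℓ) (allFin n)))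
            (allFin n)

IsSign : ℤ → Set
IsSign x = x ≡ + 0 ⊎ x ≡ + 1 ⊎ x ≡ - + 1

record IsAPM4 (n : ℕ) (h v d : Matrix ℤ n) : Set where
  field
    h-sign : ∀ i j → IsSign (h i j)
    v-sign : ∀ i j → IsSign (v i j)
    d-sign : ∀ i j → IsSign (d i j)
    sum-zero : ∀ i j → h i j ℤ.+ v i j ℤ.+ d i j ≡ + 0
    rows  : ∀ i → AltPos (row h i)
    cols  : ∀ j → AltPos (col v j)
    diags : ∀ (ℓ : ℤ) → - (+ n) ℤ.+ + 1 ℤ.≤ ℓ → ℓ ℤ.≤ + n ℤ.- + 1 →
            AltNeg (diag d ℓ)

aEntry : ∀ {n} → Matrix ℤ n → Matrix ℤ n → Matrix ℤω n
aEntry h v i j = (-ω (ω *ω ι (h i j))) +ω (ω² *ω ι (v i j))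

-- Summing over a line, a is ℤ-linear in (h, v), so the line sum is
-- -ω Σh + ω² Σv. The alternation conditions force Σh = 0 on rows, Σv = 0 on columns and
-- Σd = 0 on diagonals, where h + v + d = 0 gives Σv = -Σh. The three sums are therefore
-- ω² Σv, -ω Σh and -(ω + ω²) Σh = Σh, using 1 + ω + ω² = 0.
module Submission where

open import Defs
open import Data.Nat using (ℕ; _≥_)
open import Data.Integer as ℤ using (ℤ; +_; -_; _+_; _-_; _*_)
open import Data.Integer.Properties using (_≟_; +-identityˡ; +-identityʳ; neg-distrib-+)
open import Data.Integer.Tactic.RingSolver using (solve-∀)
open import Data.Fin using (Fin; toℕ)
open import Data.List using (List; []; _∷_; map; filter; concatMap; foldr; allFin)
open import Data.List.Properties using (map-∘; map-concatMap; concatMap-cong)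
open import Data.Product using (_×_; _,_; uncurry)
open import Relation.Nullary using (yes; no)
open import Relation.Binary.PropositionalEquality
open ≡-Reasoning

sumℤ : List ℤ → ℤ
sumℤ = foldr _+_ (+ 0)

sumℤ-nonzeros : ∀ xs → sumℤ (nonzeros xs) ≡ sumℤ xs
sumℤ-nonzeros [] = refl
sumℤ-nonzeros (x ∷ xs) with x ≟ + 0
... | yes refl = trans (sumℤ-nonzeros xs) (sym (+-identityˡ _))
... | no _ = cong (λ s → x + s) (sumℤ-nonzeros xs)

sumℤ-Alt : ∀ {a b ys} → a + b ≡ + 0 → Alt a b ys → sumℤ ys ≡ + 0
sumℤ-Alt a+b≡0 done = refl
sumℤ-Alt {a} {b} a+b≡0 (step {xs} alt) = begin
  a + (b + sumℤ xs)  ≡⟨ cong (λ s → a + (b + s)) (sumℤ-Alt a+b≡0 alt) ⟩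
  a + (b + + 0)      ≡⟨ cong (λ s → a + s) (+-identityʳ b) ⟩
  a + b              ≡⟨ a+b≡0 ⟩
  + 0                ∎

sumℤ-AltPos : ∀ xs → AltPos xs → sumℤ xs ≡ + 0
sumℤ-AltPos xs alt = trans (sym (sumℤ-nonzeros xs)) (sumℤ-Alt refl alt)

sumℤ-AltNeg : ∀ xs → AltNeg xs → sumℤ xs ≡ + 0
sumℤ-AltNeg xs alt = trans (sym (sumℤ-nonzeros xs)) (sumℤ-Alt refl alt)

sumℤ-map-sum-zero : ∀ {X : Set} (f g k : X → ℤ) → (∀ x → f x + g x + k x ≡ + 0) →
  ∀ xs → sumℤ (map f xs) + sumℤ (map g xs) + sumℤ (map k xs) ≡ + 0
sumℤ-map-sum-zero f g k pointwise [] = refl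
sumℤ-map-sum-zero f g k pointwise (x ∷ xs) = begin
  (f x + F) + (g x + G) + (k x + K)  ≡⟨ regroup (f x) (g x) (k x) F G K ⟩
  (f x + g x + k x) + (F + G + K)    ≡⟨ cong₂ _+_ (pointwise x) (sumℤ-map-sum-zero f g k pointwise xs) ⟩
  + 0                                ∎
  where
  F G K : ℤ
  F = sumℤ (map f xs)
  G = sumℤ (map g xs)
  K = sumℤ (map k xs)
  regroup : ∀ a b c A B C → (a + A) + (b + B) + (c + C) ≡ (a + b + c) + (A + B + C)
  regroup = solve-∀

*ω-ι : ∀ c k → c *ω ι k ≡ mkℤω (re c * k) (im c * k)
*ω-ι (mkℤω a b) k = cong₂ mkℤω (reIdentity a b k) (imIdentity a b k)
  where
  reIdentity : ∀ a b k → a * k - b * + 0 ≡ a * k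
  reIdentity = solve-∀
  imIdentity : ∀ a b k → a * + 0 + b * k - b * + 0 ≡ b * k
  imIdentity = solve-∀

aOf : ℤ → ℤ → ℤω
aOf x y = (-ω (ω *ω ι x)) +ω (ω² *ω ι y)

-- ω² = -1 - ω, so -ωx + ω²y = -y + (-x - y)ω.
aOf-coordinates : ∀ x y → aOf x y ≡ mkℤω (- y) (- x - y)
aOf-coordinates x y = begin
  aOf x y                            ≡⟨ cong₂ (λ p q → (-ω p) +ω q) (*ω-ι ω x) (*ω-ι ω² y) ⟩
  mkℤω (- (+ 0 * x) + (- + 1) * y)
       (- (+ 1 * x) + (- + 1) * y)  ≡⟨ cong₂ mkℤω (reIdentity x y) (imIdentity x y) ⟩
  mkℤω (- y) (- x - y)               ∎
  where
  reIdentity : ∀ x y → - (+ 0 * x) + (- + 1) * y ≡ - y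
  reIdentity = solve-∀
  imIdentity : ∀ x y → - (+ 1 * x) + (- + 1) * y ≡ - x - y
  imIdentity = solve-∀

aOf-+ : ∀ x y x′ y′ → aOf x y +ω aOf x′ y′ ≡ aOf (x + x′) (y + y′)
aOf-+ x y x′ y′ = begin
  aOf x y +ω aOf x′ y′                          ≡⟨ cong₂ _+ω_ (aOf-coordinates x y) (aOf-coordinates x′ y′) ⟩
  mkℤω (- y + - y′) ((- x - y) + (- x′ - y′))  ≡⟨ cong₂ mkℤω (reIdentity y y′) (imIdentity x y x′ y′) ⟩
  mkℤω (- (y + y′)) (- (x + x′) - (y + y′))    ≡⟨ sym (aOf-coordinates (x + x′) (y + y′)) ⟩
  aOf (x + x′) (y + y′)                         ∎
  where
  reIdentity : ∀ y y′ → - y + - y′ ≡ - (y + y′)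
  reIdentity = solve-∀
  imIdentity : ∀ x y x′ y′ → (- x - y) + (- x′ - y′) ≡ - (x + x′) - (y + y′)
  imIdentity = solve-∀

sumω-map-aOf : ∀ {X : Set} (f g : X → ℤ) xs →
  sumω (map (λ x → aOf (f x) (g x)) xs) ≡ aOf (sumℤ (map f xs)) (sumℤ (map g xs))
sumω-map-aOf f g [] = refl
sumω-map-aOf f g (x ∷ xs) =
  trans (cong (aOf (f x) (g x) +ω_) (sumω-map-aOf f g xs)) (aOf-+ (f x) (g x) _ _)

aOf-∈ω²ℤ : ∀ x y → x ≡ + 0 → aOf x y ∈ ω² ℤ
aOf-∈ω²ℤ .(+ 0) y refl = y , (begin
  aOf (+ 0) y                       ≡⟨ aOf-coordinates (+ 0) y ⟩
  mkℤω (- y) (- + 0 - y)            ≡⟨ cong₂ mkℤω (reIdentity y) (imIdentity y) ⟩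
  mkℤω ((- + 1) * y) ((- + 1) * y)  ≡⟨ sym (*ω-ι ω² y) ⟩
  ω² *ω ι y                         ∎)
  where
  reIdentity : ∀ y → - y ≡ (- + 1) * y
  reIdentity = solve-∀
  imIdentity : ∀ y → - + 0 - y ≡ (- + 1) * y
  imIdentity = solve-∀

aOf-∈ωℤ : ∀ x y → y ≡ + 0 → aOf x y ∈ ω ℤ
aOf-∈ωℤ x .(+ 0) refl = - x , (begin
  aOf x (+ 0)                         ≡⟨ aOf-coordinates x (+ 0) ⟩
  mkℤω (- + 0) (- x - + 0)            ≡⟨ cong₂ mkℤω refl (imIdentity x) ⟩
  mkℤω (+ 0 * - x) (+ 1 * - x)        ≡⟨ sym (*ω-ι ω (- x)) ⟩
  ω *ω ι (- x)                        ∎)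
  where
  imIdentity : ∀ x → - x - + 0 ≡ + 1 * - x
  imIdentity = solve-∀

aOf-∈ℤ : ∀ x y → x + y ≡ + 0 → aOf x y ∈ ι (+ 1) ℤ
aOf-∈ℤ x y x+y≡0 = - y , (begin
  aOf x y                     ≡⟨ aOf-coordinates x y ⟩
  mkℤω (- y) (- x - y)        ≡⟨ cong₂ mkℤω (reIdentity y) imaginaryPartZero ⟩
  mkℤω (+ 1 * - y) (+ 0)      ≡⟨ sym (*ω-ι (ι (+ 1)) (- y)) ⟩
  ι (+ 1) *ω ι (- y)          ∎)
  where
  reIdentity : ∀ y → - y ≡ + 1 * - y
  reIdentity = solve-∀
  imaginaryPartZero : - x - y ≡ + 0
  imaginaryPartZero = trans (sym (neg-distrib-+ x y)) (cong -_ x+y≡0)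

module _ {n : ℕ} where

  diagonalPositions : ℤ → List (Fin n × Fin n)
  diagonalPositions ℓ = concatMap (λ i → map (i ,_) (onDiagonal i)) (allFin n)
    where
    onDiagonal : Fin n → List (Fin n)
    onDiagonal i = filter (λ j → (+ toℕ j) ℤ.≟ (+ toℕ i) + ℓ) (allFin n)

  diag-diagonalPositions : ∀ {A : Set} (M : Matrix A n) ℓ →
    diag M ℓ ≡ map (uncurry M) (diagonalPositions ℓ)
  diag-diagonalPositions M ℓ = sym (trans (map-concatMap (uncurry M) _ (allFin n))
                                          (concatMap-cong (λ i → sym (map-∘ _)) (allFin n)))

proposition7p8 : (n : ℕ) → n ≥ 1 → (h v d : Matrix ℤ n) → IsAPM4 n h v d →
    ((∀ i → sumω (row (aEntry h v) i) ∈ ω² ℤ)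
    × (∀ j → sumω (col (aEntry h v) j) ∈ ω ℤ)
    × (∀ (ℓ : ℤ) → - (+ n) ℤ.+ + 1 ℤ.≤ ℓ → ℓ ℤ.≤ + n ℤ.- + 1 →
    sumω (diag (aEntry h v) ℓ) ∈ ι (+ 1) ℤ))
proposition7p8 n _ h v d apm = rowSum , colSum , diagSum
  where
  open IsAPM4 apm
  rowSum : ∀ i → sumω (row (aEntry h v) i) ∈ ω² ℤ
  rowSum i = subst (_∈ ω² ℤ) (sym (sumω-map-aOf (h i) (v i) (allFin n)))
                   (aOf-∈ω²ℤ (sumℤ (row h i)) (sumℤ (row v i)) (sumℤ-AltPos (row h i) (rows i)))
  colSum : ∀ j → sumω (col (aEntry h v) j) ∈ ω ℤ
  colSum j = subst (_∈ ω ℤ) (sym (sumω-map-aOf (λ i → h i j) (λ i → v i j) (allFin n)))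
                   (aOf-∈ωℤ (sumℤ (col h j)) (sumℤ (col v j)) (sumℤ-AltPos (col v j) (cols j)))
  diagSum : ∀ (ℓ : ℤ) → - (+ n) ℤ.+ + 1 ℤ.≤ ℓ → ℓ ℤ.≤ + n ℤ.- + 1 →
            sumω (diag (aEntry h v) ℓ) ∈ ι (+ 1) ℤ
  diagSum ℓ lo hi = subst (_∈ ι (+ 1) ℤ) (sym diagSum≡aOf) (aOf-∈ℤ H V H+V≡0)
    where
    ps : List (Fin n × Fin n)
    ps = diagonalPositions ℓ
    H V : ℤ
    H = sumℤ (map (uncurry h) ps)
    V = sumℤ (map (uncurry v) ps)
    diagSum≡aOf : sumω (diag (aEntry h v) ℓ) ≡ aOf H V
    diagSum≡aOf = trans (cong sumω (diag-diagonalPositions (aEntry h v) ℓ))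
                        (sumω-map-aOf (uncurry h) (uncurry v) ps)
    D≡0 : sumℤ (map (uncurry d) ps) ≡ + 0
    D≡0 = trans (cong sumℤ (sym (diag-diagonalPositions d ℓ))) (sumℤ-AltNeg (diag d ℓ) (diags ℓ lo hi))
    H+V≡0 : H + V ≡ + 0
    H+V≡0 = begin
      H + V                               ≡⟨ sym (+-identityʳ _) ⟩
      H + V + + 0                         ≡⟨ cong (λ s → H + V + s) (sym D≡0) ⟩
      H + V + sumℤ (map (uncurry d) ps)   ≡⟨ sumℤ-map-sum-zero (uncurry h) (uncurry v) (uncurry d) (uncurry sum-zero) ps ⟩
      + 0                                 ∎
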